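{- Let $A$ be a real square matrix. If $A$ has a real eigenvector $\bar{x}$ (left or right) with all entries non-negative and some entry $x_i=0$, then $A$ is not algebraically positive.
   Context: A real matrix is positive if all its entries are positive; a real square matrix $M$ is algebraically positive if $f(M)$ is positive for some real polynomial $f$. A right eigenvector is a nonzero $\bar{x}$ with $A\bar{x}=\lambda\bar{x}$; a left eigenvector is a nonzero $\bar{x}$ with $\bar{x}^TA=\lambda\bar{x}^T$. -}

module Defs where

open import Level using (Level; _⊔_; suc)
open import Algebra.Bundles using (CommutativeRing)
open import Data.Nat using (ℕ; zero) renaming (suc to sucℕ)
open import Data.Fin using (Fin) renaming (zero to fz; suc to fs)
open import Data.List using (List; []; _∷_)
open import Data.Product using (Σ; ∃; ∃-syntax; _×_; _,_)
open import Data.Sum using (_⊎_)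
open import Relation.Nullary using (¬_)

-- Axioms of the real numbers (a complete ordered field) on top of a
-- commutative ring with setoid equality.  Every model is (classically)
-- isomorphic to ℝ, so quantifying over all models states the result for ℝ.
record IsRealField {c ℓ : Level} (R : CommutativeRing c ℓ) : Set (suc (c ⊔ ℓ)) where
  open CommutativeRing R
  field
    _<_        : Carrier → Carrier → Set ℓ
    <-resp-≈   : ∀ {x x' y y'} → x ≈ x' → y ≈ y' → x < y → x' < y'
    <-irrefl   : ∀ {x} → ¬ (x < x)
    <-trans    : ∀ {x y z} → x < y → y < z → x < z
    <-trichot  : ∀ x y → (x < y) ⊎ ((x ≈ y) ⊎ (y < x))
    +-mono-<   : ∀ {x y} z → x < y → (x + z) < (y + z)
    *-pos      : ∀ {x y} → 0# < x → 0# < y → 0# < (x * y)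
    0≉1        : ¬ (0# ≈ 1#)
    inverse    : ∀ x → ¬ (x ≈ 0#) → ∃[ y ] (x * y ≈ 1#)
    sup        : (S : Carrier → Set (c ⊔ ℓ)) → (∃[ x ] S x) →
                 (∃[ b ] (∀ x → S x → (x < b) ⊎ (x ≈ b))) →
                 ∃[ u ] ((∀ x → S x → (x < u) ⊎ (x ≈ u)) ×
                         (∀ b → (∀ x → S x → (x < b) ⊎ (x ≈ b)) → (u < b) ⊎ (u ≈ b)))

module RealMatrices {c ℓ : Level} (R : CommutativeRing c ℓ) (O : IsRealField R) where
  open CommutativeRing R
  open IsRealField O

  _≤_ : Carrier → Carrier → Set ℓ
  x ≤ y = (x < y) ⊎ (x ≈ y)

  ∑ : ∀ {n} → (Fin n → Carrier) → Carrier
  ∑ {zero}   f = 0#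
  ∑ {sucℕ n} f = f fz + ∑ (λ i → f (fs i))

  Mat : ℕ → Set c
  Mat n = Fin n → Fin n → Carrier

  Vec : ℕ → Set c
  Vec n = Fin n → Carrier

  _⊗_ : ∀ {n} → Mat n → Mat n → Mat n
  (M ⊗ N) i j = ∑ (λ k → M i k * N k j)

  _⊕_ : ∀ {n} → Mat n → Mat n → Mat n
  (M ⊕ N) i j = M i j + N i j

  idMat : ∀ {n} → Mat n
  idMat {sucℕ n} fz     fz     = 1#
  idMat {sucℕ n} fz     (fs j) = 0#
  idMat {sucℕ n} (fs i) fz     = 0#
  idMat {sucℕ n} (fs i) (fs j) = idMat i j

  _·_ : ∀ {n} → Carrier → Mat n → Mat n
  (a · M) i j = a * M i j

  -- real polynomial given by its coefficient list c₀ ∷ c₁ ∷ … (f = Σ cₖ xᵏ),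
  -- evaluated at a matrix by Horner's rule: f(M) = c₀ I + M · (c₁ + c₂ x + …)(M)
  evalPoly : ∀ {n} → List Carrier → Mat n → Mat n
  evalPoly []       M i j = 0#
  evalPoly (a ∷ as) M     = (a · idMat) ⊕ (M ⊗ evalPoly as M)

  Positive : ∀ {n} → Mat n → Set ℓ
  Positive M = ∀ i j → 0# < M i j

  AlgebraicallyPositive : ∀ {n} → Mat n → Set (c ⊔ ℓ)
  AlgebraicallyPositive {n} M = ∃[ f ] Positive (evalPoly {n} f M)

  NonzeroVec : ∀ {n} → Vec n → Set ℓ
  NonzeroVec x = ∃[ i ] ¬ (x i ≈ 0#)

  IsRightEigenvector : ∀ {n} → Mat n → Carrier → Vec n → Set ℓ
  IsRightEigenvector A λ' x = NonzeroVec x × (∀ i → ∑ (λ k → A i k * x k) ≈ λ' * x i)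

  IsLeftEigenvector : ∀ {n} → Mat n → Carrier → Vec n → Set ℓ
  IsLeftEigenvector A λ' x = NonzeroVec x × (∀ j → ∑ (λ k → x k * A k j) ≈ λ' * x j)

{-# OPTIONS --safe #-}
-- If x is a right eigenvector of A for λ, then f(A) x = f(λ) x for every
-- polynomial f, so the i-th entry of f(A) x is f(λ) xᵢ = 0.  But a positive
-- matrix sends a non-negative nonzero vector to a positive one.  A left
-- eigenvector of A is a right eigenvector of Aᵀ, and f(A)ᵀ x = f(λ) x likewise.
module Submission where

open import Defs
open import Level using (Level)
open import Algebra.Bundles using (CommutativeRing)
open import Data.Nat using (ℕ; zero; suc)
open import Data.Fin using (Fin) renaming (zero to fz; suc to fs)
open import Data.List using (List; []; _∷_)
open import Data.Product using (∃-syntax; _,_)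
open import Data.Sum using (_⊎_; inj₁; inj₂)
open import Data.Vec.Functional using (map; zipWith)
open import Data.Empty using (⊥-elim)
open import Function using (_∘_)
open import Relation.Binary.PropositionalEquality as ≡ using (_≡_)
open import Relation.Nullary using (¬_)

module MatrixAlgebra {c ℓ : Level} (R : CommutativeRing c ℓ) (O : IsRealField R) where
  open CommutativeRing R
  open RealMatrices R O
  open import Algebra.Properties.CommutativeSemigroup *-commutativeSemigroup using (x∙yz≈y∙xz)
  import Algebra.Properties.Semiring.Sum semiring as Σ
  open import Data.Vec.Functional.Relation.Binary.Equality.Setoid setoid using (_≋_)
  open import Relation.Binary.Reasoning.Setoid setoid

  ∑≡sum : ∀ {n} (f : Vec n) → ∑ f ≡ Σ.sum f
  ∑≡sum {zero}  f = ≡.refl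
  ∑≡sum {suc n} f = ≡.cong (f fz +_) (∑≡sum (f ∘ fs))

  ∑∑≡sumsum : ∀ {m n} (f : Fin m → Fin n → Carrier) →
              ∑ (λ i → ∑ (f i)) ≡ Σ.sum (λ i → Σ.sum (f i))
  ∑∑≡sumsum f = ≡.trans (∑≡sum (λ i → ∑ (f i))) (Σ.sum-cong-≗ (∑≡sum ∘ f))

  ∑-cong : ∀ {n} {f g : Vec n} → (∀ i → f i ≈ g i) → ∑ f ≈ ∑ g
  ∑-cong {zero}  f≈g = refl
  ∑-cong {suc n} f≈g = +-cong (f≈g fz) (∑-cong (f≈g ∘ fs))

  ∑-zero : ∀ {n} {f : Vec n} → (∀ i → f i ≈ 0#) → ∑ f ≈ 0#
  ∑-zero {zero}  f≈0 = refl
  ∑-zero {suc n} f≈0 = trans (+-cong (f≈0 fz) (∑-zero (f≈0 ∘ fs))) (+-identityʳ 0#)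

  ∑-distrib-+ : ∀ {n} (f g : Vec n) → ∑ (λ i → f i + g i) ≈ ∑ f + ∑ g
  ∑-distrib-+ f g = begin
    ∑ (λ i → f i + g i)      ≡⟨ ∑≡sum (λ i → f i + g i) ⟩
    Σ.sum (λ i → f i + g i)  ≈⟨ Σ.∑-distrib-+ f g ⟩
    Σ.sum f + Σ.sum g        ≡⟨ ≡.cong₂ _+_ (∑≡sum f) (∑≡sum g) ⟨
    ∑ f + ∑ g                ∎

  ∑-comm : ∀ {m n} (f : Fin m → Fin n → Carrier) →
           ∑ (λ i → ∑ (f i)) ≈ ∑ (λ j → ∑ (λ i → f i j))
  ∑-comm f = begin
    ∑ (λ i → ∑ (f i))                     ≡⟨ ∑∑≡sumsum f ⟩
    Σ.sum (λ i → Σ.sum (f i))             ≈⟨ Σ.∑-comm f ⟩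
    Σ.sum (λ j → Σ.sum (λ i → f i j))     ≡⟨ ∑∑≡sumsum (λ j i → f i j) ⟨
    ∑ (λ j → ∑ (λ i → f i j))             ∎

  *-distribˡ-∑ : ∀ {n} a (f : Vec n) → a * ∑ f ≈ ∑ (λ i → a * f i)
  *-distribˡ-∑ {zero}  a f = zeroʳ a
  *-distribˡ-∑ {suc n} a f = trans (distribˡ a (f fz) _) (+-congˡ (*-distribˡ-∑ a (f ∘ fs)))

  *-distribʳ-∑ : ∀ {n} a (f : Vec n) → ∑ f * a ≈ ∑ (λ i → f i * a)
  *-distribʳ-∑ {zero}  a f = zeroˡ a
  *-distribʳ-∑ {suc n} a f = trans (distribʳ a (f fz) _) (+-congˡ (*-distribʳ-∑ a (f ∘ fs)))

  infixr 7 _▷_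
  _▷_ : ∀ {n} → Mat n → Vec n → Vec n
  (M ▷ x) i = ∑ (λ k → M i k * x k)

  infix 30 _ᵀ
  _ᵀ : ∀ {n} → Mat n → Mat n
  (M ᵀ) i j = M j i

  ▷-congˡ : ∀ {n} {M N : Mat n} → (∀ i j → M i j ≈ N i j) → ∀ x → M ▷ x ≋ N ▷ x
  ▷-congˡ M≈N x i = ∑-cong (λ k → *-congʳ (M≈N i k))

  ▷-congʳ : ∀ {n} (M : Mat n) {x y : Vec n} → x ≋ y → M ▷ x ≋ M ▷ y
  ▷-congʳ M x≋y i = ∑-cong (λ k → *-congˡ (x≋y k))

  ⊕-▷ : ∀ {n} (M N : Mat n) x → (M ⊕ N) ▷ x ≋ zipWith _+_ (M ▷ x) (N ▷ x)
  ⊕-▷ M N x i = trans (∑-cong (λ k → distribʳ (x k) (M i k) (N i k)))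
                      (∑-distrib-+ (λ k → M i k * x k) (λ k → N i k * x k))

  ·-▷ : ∀ {n} a (M : Mat n) x → (a · M) ▷ x ≋ map (a *_) (M ▷ x)
  ·-▷ a M x i = trans (∑-cong (λ k → *-assoc a (M i k) (x k)))
                      (sym (*-distribˡ-∑ a (λ k → M i k * x k)))

  ▷-map-* : ∀ {n} (M : Mat n) a x → M ▷ map (a *_) x ≋ map (a *_) (M ▷ x)
  ▷-map-* M a x i = trans (∑-cong (λ k → x∙yz≈y∙xz (M i k) a (x k)))
                          (sym (*-distribˡ-∑ a (λ k → M i k * x k)))

  idMat-▷ : ∀ {n} (x : Vec n) → idMat ▷ x ≋ x
  idMat-▷ {suc n} x fz = begin
    1# * x fz + ∑ (λ k → 0# * x (fs k))  ≈⟨ +-cong (*-identityˡ _) (∑-zero (λ k → zeroˡ (x (fs k)))) ⟩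
    x fz + 0#                            ≈⟨ +-identityʳ _ ⟩
    x fz                                 ∎
  idMat-▷ {suc n} x (fs i) = begin
    0# * x fz + (idMat ▷ (x ∘ fs)) i  ≈⟨ +-cong (zeroˡ _) (idMat-▷ (x ∘ fs) i) ⟩
    0# + x (fs i)                     ≈⟨ +-identityˡ _ ⟩
    x (fs i)                          ∎

  idMat-symmetric : ∀ {n} (i j : Fin n) → idMat i j ≡ idMat j i
  idMat-symmetric fz     fz     = ≡.refl
  idMat-symmetric fz     (fs j) = ≡.refl
  idMat-symmetric (fs i) fz     = ≡.refl
  idMat-symmetric (fs i) (fs j) = idMat-symmetric i j

  idMatᵀ-▷ : ∀ {n} (x : Vec n) → idMat ᵀ ▷ x ≋ x
  idMatᵀ-▷ x i = trans (▷-congˡ (λ i j → reflexive (idMat-symmetric j i)) x i) (idMat-▷ x i)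

  ⊗-▷ : ∀ {n} (M N : Mat n) x → (M ⊗ N) ▷ x ≋ M ▷ (N ▷ x)
  ⊗-▷ M N x i = begin
    ∑ (λ k → ∑ (λ m → M i m * N m k) * x k)    ≈⟨ ∑-cong (λ k → *-distribʳ-∑ (x k) (λ m → M i m * N m k)) ⟩
    ∑ (λ k → ∑ (λ m → M i m * N m k * x k))    ≈⟨ ∑-comm (λ k m → M i m * N m k * x k) ⟩
    ∑ (λ m → ∑ (λ k → M i m * N m k * x k))    ≈⟨ ∑-cong (λ m → ∑-cong (λ k → *-assoc (M i m) (N m k) (x k))) ⟩
    ∑ (λ m → ∑ (λ k → M i m * (N m k * x k)))  ≈⟨ ∑-cong (λ m → *-distribˡ-∑ (M i m) (λ k → N m k * x k)) ⟨
    ∑ (λ m → M i m * (N ▷ x) m)                ∎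

  ⊗-ᵀ : ∀ {n} (M N : Mat n) i j → ((M ⊗ N) ᵀ) i j ≈ (N ᵀ ⊗ M ᵀ) i j
  ⊗-ᵀ M N i j = ∑-cong (λ k → *-comm (M j k) (N k i))

  evalPolyScalar : List Carrier → Carrier → Carrier
  evalPolyScalar []       t = 0#
  evalPolyScalar (a ∷ as) t = a + t * evalPolyScalar as t

  horner-step : ∀ a t p y → a * y + t * (p * y) ≈ (a + t * p) * y
  horner-step a t p y = sym (trans (distribʳ y a (t * p)) (+-congˡ (*-assoc t p y)))

  evalPoly-▷ : ∀ {n} {A : Mat n} {t x} → A ▷ x ≋ map (t *_) x →
               ∀ f → evalPoly f A ▷ x ≋ map (evalPolyScalar f t *_) x
  evalPoly-▷ {x = x} Ax≋tx [] i = trans (∑-zero (λ k → zeroˡ (x k))) (sym (zeroˡ (x i)))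
  evalPoly-▷ {A = A} {t} {x} Ax≋tx (a ∷ as) i = begin
    (((a · idMat) ⊕ (A ⊗ E)) ▷ x) i        ≈⟨ ⊕-▷ (a · idMat) (A ⊗ E) x i ⟩
    ((a · idMat) ▷ x) i + ((A ⊗ E) ▷ x) i  ≈⟨ +-cong (trans (·-▷ a idMat x i) (*-congˡ (idMat-▷ x i)))
                                                     (⊗-▷ A E x i) ⟩
    a * x i + (A ▷ E ▷ x) i                ≈⟨ +-congˡ (▷-congʳ A (evalPoly-▷ Ax≋tx as) i) ⟩
    a * x i + (A ▷ map (p *_) x) i         ≈⟨ +-congˡ (trans (▷-map-* A p x i) (*-congˡ (Ax≋tx i))) ⟩
    a * x i + p * (t * x i)                ≈⟨ +-congˡ (x∙yz≈y∙xz p t (x i)) ⟩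
    a * x i + t * (p * x i)                ≈⟨ horner-step a t p (x i) ⟩
    (a + t * p) * x i                      ∎
    where E = evalPoly as A
          p = evalPolyScalar as t

  -- Transposing the Horner form gives f(A)ᵀ = a I + Eᵀ Aᵀ, so this needs no
  -- proof that A commutes with E = g(A), as relating f(Aᵀ) to f(A)ᵀ would.
  evalPolyᵀ-▷ : ∀ {n} {A : Mat n} {t x} → A ᵀ ▷ x ≋ map (t *_) x →
                ∀ f → evalPoly f A ᵀ ▷ x ≋ map (evalPolyScalar f t *_) x
  evalPolyᵀ-▷ {x = x} Aᵀx≋tx [] i = trans (∑-zero (λ k → zeroˡ (x k))) (sym (zeroˡ (x i)))
  evalPolyᵀ-▷ {A = A} {t} {x} Aᵀx≋tx (a ∷ as) i = begin
    (((a · idMat ᵀ) ⊕ (A ⊗ E) ᵀ) ▷ x) i        ≈⟨ ⊕-▷ (a · idMat ᵀ) ((A ⊗ E) ᵀ) x i ⟩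
    ((a · idMat ᵀ) ▷ x) i + ((A ⊗ E) ᵀ ▷ x) i  ≈⟨ +-cong (trans (·-▷ a (idMat ᵀ) x i) (*-congˡ (idMatᵀ-▷ x i)))
                                                         (▷-congˡ (⊗-ᵀ A E) x i) ⟩
    a * x i + ((E ᵀ ⊗ A ᵀ) ▷ x) i              ≈⟨ +-congˡ (⊗-▷ (E ᵀ) (A ᵀ) x i) ⟩
    a * x i + (E ᵀ ▷ A ᵀ ▷ x) i                ≈⟨ +-congˡ (▷-congʳ (E ᵀ) Aᵀx≋tx i) ⟩
    a * x i + (E ᵀ ▷ map (t *_) x) i           ≈⟨ +-congˡ (trans (▷-map-* (E ᵀ) t x i)
                                                                 (*-congˡ (evalPolyᵀ-▷ Aᵀx≋tx as i))) ⟩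
    a * x i + t * (p * x i)                    ≈⟨ horner-step a t p (x i) ⟩
    (a + t * p) * x i                          ∎
    where E = evalPoly as A
          p = evalPolyScalar as t

  leftEigenvector⇒ᵀ▷ : ∀ {n} {A : Mat n} {t x} → IsLeftEigenvector A t x →
                       A ᵀ ▷ x ≋ map (t *_) x
  leftEigenvector⇒ᵀ▷ {A = A} {x = x} (_ , xA≈tx) j =
    trans (∑-cong (λ k → *-comm (A k j) (x k))) (xA≈tx j)

module Positivity {c ℓ : Level} (R : CommutativeRing c ℓ) (O : IsRealField R) where
  open CommutativeRing R
  open IsRealField O
  open RealMatrices R O
  open MatrixAlgebra R O using (_▷_)
  open import Data.Vec.Functional.Relation.Binary.Equality.Setoid setoid using (_≋_)

  pos+nonneg⇒pos : ∀ {a b} → 0# < a → 0# ≤ b → 0# < (a + b)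
  pos+nonneg⇒pos {a} {b} 0<a (inj₁ 0<b) =
    <-trans (<-resp-≈ refl (sym (+-identityˡ b)) 0<b) (+-mono-< b 0<a)
  pos+nonneg⇒pos {a} {b} 0<a (inj₂ 0≈b) =
    <-resp-≈ refl (trans (sym (+-identityʳ a)) (+-congˡ 0≈b)) 0<a

  nonneg+pos⇒pos : ∀ {a b} → 0# ≤ a → 0# < b → 0# < (a + b)
  nonneg+pos⇒pos 0≤a 0<b = <-resp-≈ refl (+-comm _ _) (pos+nonneg⇒pos 0<b 0≤a)

  nonneg+nonneg⇒nonneg : ∀ {a b} → 0# ≤ a → 0# ≤ b → 0# ≤ (a + b)
  nonneg+nonneg⇒nonneg (inj₁ 0<a) 0≤b        = inj₁ (pos+nonneg⇒pos 0<a 0≤b)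
  nonneg+nonneg⇒nonneg 0≤a        (inj₁ 0<b) = inj₁ (nonneg+pos⇒pos 0≤a 0<b)
  nonneg+nonneg⇒nonneg (inj₂ 0≈a) (inj₂ 0≈b) = inj₂ (trans (sym (+-identityʳ 0#)) (+-cong 0≈a 0≈b))

  pos*nonneg⇒nonneg : ∀ {a b} → 0# < a → 0# ≤ b → 0# ≤ (a * b)
  pos*nonneg⇒nonneg 0<a (inj₁ 0<b) = inj₁ (*-pos 0<a 0<b)
  pos*nonneg⇒nonneg {a} 0<a (inj₂ 0≈b) = inj₂ (trans (sym (zeroʳ a)) (*-congˡ 0≈b))

  nonneg∧≉0⇒pos : ∀ {b} → 0# ≤ b → ¬ (b ≈ 0#) → 0# < b
  nonneg∧≉0⇒pos (inj₁ 0<b) _   = 0<b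
  nonneg∧≉0⇒pos (inj₂ 0≈b) b≉0 = ⊥-elim (b≉0 (sym 0≈b))

  ∑-nonneg : ∀ {n} {f : Vec n} → (∀ k → 0# ≤ f k) → 0# ≤ ∑ f
  ∑-nonneg {zero}  f≥0 = inj₂ refl
  ∑-nonneg {suc n} f≥0 = nonneg+nonneg⇒nonneg (f≥0 fz) (∑-nonneg (f≥0 ∘ fs))

  ∑-pos : ∀ {n} {f : Vec n} → (∀ k → 0# ≤ f k) → ∃[ k ] (0# < f k) → 0# < ∑ f
  ∑-pos {suc n} f≥0 (fz   , 0<fₖ) = pos+nonneg⇒pos 0<fₖ (∑-nonneg (f≥0 ∘ fs))
  ∑-pos {suc n} f≥0 (fs k , 0<fₖ) = nonneg+pos⇒pos (f≥0 fz) (∑-pos (f≥0 ∘ fs) (k , 0<fₖ))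

  positive-▷-pos : ∀ {n} {M : Mat n} {x : Vec n} → Positive M → (∀ k → 0# ≤ x k) → NonzeroVec x →
                   ∀ i → 0# < (M ▷ x) i
  positive-▷-pos M>0 x≥0 (k , xₖ≉0) i =
    ∑-pos (λ k → pos*nonneg⇒nonneg (M>0 i k) (x≥0 k))
          (k , *-pos (M>0 i k) (nonneg∧≉0⇒pos (x≥0 k) xₖ≉0))

  eigenvector-with-zero-entry⇒¬Positive :
    ∀ {n} (P : Mat n) {t} {x : Vec n} → P ▷ x ≋ map (t *_) x →
    (∀ k → 0# ≤ x k) → NonzeroVec x → ∀ {i} → x i ≈ 0# → ¬ Positive P
  eigenvector-with-zero-entry⇒¬Positive P {t} Px≋tx x≥0 x≢0 {i} xᵢ≈0 P>0 =
    <-irrefl (<-resp-≈ refl (trans (Px≋tx i) (trans (*-congˡ xᵢ≈0) (zeroʳ t)))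
                       (positive-▷-pos P>0 x≥0 x≢0 i))

lemma2p2 : ∀ {c ℓ : Level} (R : CommutativeRing c ℓ) (O : IsRealField R) →
    let open CommutativeRing R
        open RealMatrices R O
    in ∀ (n : ℕ) (A : Mat n) (x : Vec n) →
       (∃[ λ' ] (IsRightEigenvector A λ' x ⊎ IsLeftEigenvector A λ' x)) →
       (∀ i → 0# ≤ x i) →
       (∃[ i ] (x i ≈ 0#)) →
       ¬ AlgebraicallyPositive A
lemma2p2 R O n A x (t , inj₁ (x≢0 , Ax≋tx)) x≥0 (i , xᵢ≈0) (f , f[A]>0) =
  eigenvector-with-zero-entry⇒¬Positive (evalPoly f A) (evalPoly-▷ Ax≋tx f) x≥0 x≢0 xᵢ≈0 f[A]>0
  where open RealMatrices R O
        open MatrixAlgebra R O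
        open Positivity R O
lemma2p2 R O n A x (t , inj₂ xA≈tx@(x≢0 , _)) x≥0 (i , xᵢ≈0) (f , f[A]>0) =
  eigenvector-with-zero-entry⇒¬Positive (evalPoly f A ᵀ) (evalPolyᵀ-▷ (leftEigenvector⇒ᵀ▷ xA≈tx) f)
    x≥0 x≢0 xᵢ≈0 (λ j k → f[A]>0 k j)
  where open RealMatrices R O
        open MatrixAlgebra R O
        open Positivity R O
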